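{- Let $A,a$ be positive integers. For every non-negative integer $n$, $$p_{A,a}(n)=p(n)+\sum_{m\geq 1}\left[p\!\left(n-\Big(A\binom{2m}{2}+2am\Big)\right)-p\!\left(n-\Big(A\binom{2m-1}{2}+a(2m-1)\Big)\right)\right].$$
   Context: A partition of a non-negative integer $n$ is a finite multiset of positive integers summing to $n$; $p(n)$ is the number of partitions of $n$, with $p(0)=1$ and $p(k)=0$ for $k<0$. For positive integers $A,a$ and a partition $\pi$, $\mathrm{mex}_{A,a}(\pi)$ is the smallest element of $\{a,a+A,a+2A,\dots\}$ that is not a part of $\pi$. $p_{A,a}(n)$ is the number of partitions $\pi$ of $n$ with $\mathrm{mex}_{A,a}(\pi)\equiv a \pmod{2A}$. -}

module Defs where

open import Data.Nat using (ℕ; zero; suc; _+_; _*_; _∸_; _≤_; _≡ᵇ_; _%_; NonZero)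
open import Data.Nat.Combinatorics using (_C_)
open import Data.Integer as ℤ using (ℤ; +_; -[1+_]; _-_)
open import Data.Bool using (Bool; true; false; if_then_else_)
open import Data.List using (List; []; _∷_; map; concatMap; upTo; filter; length)
open import Data.Vec using (Vec; []; _∷_)
open import Relation.Nullary.Decidable using (does)
open import Relation.Unary using (Pred)
open import Data.Nat.Properties using (_≟_; m*n≢0)

-- A partition of n is represented by its multiplicity vector:
-- entry i (0-based) of a  Vec ℕ n  is the multiplicity of the part (i+1).
-- (Every part of a partition of n lies in 1..n, so this is exactly the
-- multiset of positive integers.)

multOf : ∀ {k} → Vec ℕ k → ℕ → ℕ
multOf v zero = 0
multOf [] (suc q) = 0
multOf (x ∷ v) (suc zero) = x
multOf (x ∷ v) (suc (suc q)) = multOf v (suc q)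

weightFrom : ∀ {k} → ℕ → Vec ℕ k → ℕ
weightFrom s [] = 0
weightFrom s (x ∷ v) = s * x + weightFrom (suc s) v

weight : ∀ {k} → Vec ℕ k → ℕ
weight = weightFrom 1

allVecs : (k b : ℕ) → List (Vec ℕ k)
allVecs zero b = [] ∷ []
allVecs (suc k) b = concatMap (λ x → map (x ∷_) (allVecs k b)) (upTo (suc b))

partitions : (n : ℕ) → List (Vec ℕ n)
partitions n = filter (λ v → weight v ≟ n) (allVecs n n)

p : ℕ → ℕ
p n = length (partitions n)

pℤ : ℤ → ℕ
pℤ (+ n) = p n
pℤ -[1+ _ ] = 0

-- For a partition of n with A,a ≥ 1, fuel n+1 from
-- j0 = 0 always suffices since a + n*A > n is never a part.
mexIdxFrom : ∀ {k} → (A a : ℕ) → Vec ℕ k → (fuel j : ℕ) → ℕ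
mexIdxFrom A a v zero j = j
mexIdxFrom A a v (suc fuel) j =
  if multOf v (a + j * A) ≡ᵇ 0 then j else mexIdxFrom A a v fuel (suc j)

mexIdx : ∀ {n} → (A a : ℕ) → Vec ℕ n → ℕ
mexIdx {n} A a v = mexIdxFrom A a v (suc n) 0

mex : ∀ {n} → (A a : ℕ) → Vec ℕ n → ℕ
mex A a v = a + mexIdx A a v * A

pAa : (A a : ℕ) → .{{NonZero A}} → ℕ → ℕ
pAa A a n = length (filter (λ v → _%_ (mex A a v) (2 * A) {{m*n≢0 2 A}} ≟ _%_ a (2 * A) {{m*n≢0 2 A}}) (partitions n))

sumFrom1 : ℕ → (ℕ → ℤ) → ℤ
sumFrom1 zero f = + 0
sumFrom1 (suc N) f = sumFrom1 N f ℤ.+ f (suc N)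

term : (A a n m : ℕ) → ℤ
term A a n m =
    + pℤ (+ n - + (A * ((2 * m) C 2) + 2 * a * m))
  - + pℤ (+ n - + (A * ((2 * m ∸ 1) C 2) + a * (2 * m ∸ 1)))

module Submission where

-- Let μ(π) be the index j of mex_{A,a}(π) = a + jA, so that the mex is ≡ a (mod 2A) exactly when
-- μ(π) is even. A partition π of n has μ(π) ≥ t iff it contains the parts a, a + A, …, a + (t − 1)A,
-- and removing one copy of each is a bijection onto the partitions of n − S_t, S_t = A·C(t,2) + a·t;
-- hence X_t := #{π : μ(π) ≥ t} = p(n − S_t). Splitting by the parity of μ − t gives
-- X_t = c_t + c_{t+1} with c_t := #{π : μ(π) ≥ t, μ(π) ≡ t (mod 2)}, and the alternating sum
-- telescopes: p_{A,a}(n) = c_0 = X_0 + Σ_{m=1}^{N} (X_{2m} − X_{2m−1}) − c_{2N+1}, where c_{2N+1} = 0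
-- because μ(π) ≤ n.

open import Data.Bool using (Bool; true; false; _∧_; not; if_then_else_)
open import Data.Bool.Properties using (∧-zeroʳ; ∧-identityʳ; ∧-assoc; ∧-conicalˡ; ∧-conicalʳ; not-involutive)
open import Data.Integer as ℤ using (ℤ)
import Data.Integer.Properties as ℤP
import Data.Integer.Solver
open import Data.List using (List; []; _∷_; map; concatMap; applyUpTo; filter; length; _++_)
open import Data.Nat using (ℕ; zero; suc; _+_; _*_; _∸_; _≤_; _<_; z≤n; s≤s; NonZero; _≡ᵇ_; ≢-nonZero⁻¹)
open import Data.Nat.Combinatorics using (_C_; nC1≡n; nCk+nC[k+1]≡[n+1]C[k+1])
open import Data.Nat.DivMod using (_%_; _/_; m≡m%n+[m/n]*n; [m+kn]%n≡m%n)
open import Data.Nat.Divisibility using (_∣_; divides; ∣m+n∣m⇒∣n; >⇒∤)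
open import Data.Nat.Properties
open import Data.Nat.Solver using (module +-*-Solver)
open import Data.Product using (_×_; _,_)
open import Data.Sum using (inj₁; inj₂)
open import Data.Vec using (Vec; []; _∷_; replicate)
open import Function using (_∘_; _⇔_; mk⇔; Equivalence)
open import Function.Construct.Composition using (_⇔-∘_)
open import Level using (0ℓ)
open import Relation.Binary.Definitions using (tri<; tri≈; tri>)
open import Relation.Binary.PropositionalEquality
open import Relation.Nullary using (Dec; yes; no; does; ¬_)
open import Relation.Nullary.Decidable using (dec-true; dec-false; does-⇔)
open import Relation.Nullary.Negation using (contradiction)
open import Relation.Unary using (Pred; Decidable)
open import Algebra.Properties.CommutativeSemigroup +-commutativeSemigroup
  using () renaming (interchange to +-interchange)

open import Defs

module ℤSolver = Data.Integer.Solver.+-*-Solver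

private
  variable
    X Y : Set

from-does : {P : Set} (P? : Dec P) → does P? ≡ true → P
from-does (yes p) _ = p

if-yes : ∀ {P : Set} (P? : Dec P) {x y : ℕ} → P → (if does P? then x else y) ≡ x
if-yes P? p = cong (if_then _ else _) (dec-true P? p)

if-no : ∀ {P : Set} (P? : Dec P) {x y : ℕ} → ¬ P → (if does P? then x else y) ≡ y
if-no P? ¬p = cong (if_then _ else _) (dec-false P? ¬p)

⟦_⟧ : Bool → ℕ
⟦ true ⟧ = 1
⟦ false ⟧ = 0

count : (X → Bool) → List X → ℕ
count f [] = 0
count f (x ∷ xs) = ⟦ f x ⟧ + count f xs

length≡count-true : (xs : List X) → length xs ≡ count (λ _ → true) xs
length≡count-true [] = refl
length≡count-true (x ∷ xs) = cong suc (length≡count-true xs)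

length-filter : {P : Pred X 0ℓ} (P? : Decidable P) (xs : List X) →
  length (filter P? xs) ≡ count (does ∘ P?) xs
length-filter P? [] = refl
length-filter P? (x ∷ xs) with does (P? x)
... | true = cong suc (length-filter P? xs)
... | false = length-filter P? xs

count-filter : {P : Pred X 0ℓ} (P? : Decidable P) (f : X → Bool) (xs : List X) →
  count f (filter P? xs) ≡ count (λ x → does (P? x) ∧ f x) xs
count-filter P? f [] = refl
count-filter P? f (x ∷ xs) with does (P? x)
... | true = cong (⟦ f x ⟧ +_) (count-filter P? f xs)
... | false = count-filter P? f xs

count-cong : {f g : X → Bool} → f ≗ g → (xs : List X) → count f xs ≡ count g xs
count-cong f≗g [] = refl
count-cong f≗g (x ∷ xs) = cong₂ _+_ (cong ⟦_⟧ (f≗g x)) (count-cong f≗g xs)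

count-false : {f : X → Bool} → (∀ x → f x ≡ false) → (xs : List X) → count f xs ≡ 0
count-false f≡false [] = refl
count-false f≡false (x ∷ xs) rewrite f≡false x = count-false f≡false xs

count-+ : {f g h : X → Bool} → (∀ x → ⟦ h x ⟧ ≡ ⟦ f x ⟧ + ⟦ g x ⟧) →
  (xs : List X) → count h xs ≡ count f xs + count g xs
count-+ split [] = refl
count-+ {f = f} {g} {h} split (x ∷ xs) = begin
  ⟦ h x ⟧ + count h xs                          ≡⟨ cong₂ _+_ (split x) (count-+ split xs) ⟩
  (⟦ f x ⟧ + ⟦ g x ⟧) + (count f xs + count g xs) ≡⟨ +-interchange ⟦ f x ⟧ ⟦ g x ⟧ (count f xs) (count g xs) ⟩
  (⟦ f x ⟧ + count f xs) + (⟦ g x ⟧ + count g xs) ∎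
  where open ≡-Reasoning

count-++ : (f : X → Bool) (xs ys : List X) → count f (xs ++ ys) ≡ count f xs + count f ys
count-++ f [] ys = refl
count-++ f (x ∷ xs) ys = trans (cong (⟦ f x ⟧ +_) (count-++ f xs ys)) (sym (+-assoc ⟦ f x ⟧ _ _))

count-map : (f : Y → Bool) (g : X → Y) (xs : List X) → count f (map g xs) ≡ count (f ∘ g) xs
count-map f g [] = refl
count-map f g (x ∷ xs) = cong (⟦ f (g x) ⟧ +_) (count-map f g xs)

sumBelow : ℕ → (ℕ → ℕ) → ℕ
sumBelow zero f = 0
sumBelow (suc c) f = f 0 + sumBelow c (f ∘ suc)

sumBelow-cong : ∀ c {f g : ℕ → ℕ} → f ≗ g → sumBelow c f ≡ sumBelow c g
sumBelow-cong zero f≗g = refl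
sumBelow-cong (suc c) f≗g = cong₂ _+_ (f≗g 0) (sumBelow-cong c (f≗g ∘ suc))

sumBelow-zero : ∀ c {f : ℕ → ℕ} → (∀ x → f x ≡ 0) → sumBelow c f ≡ 0
sumBelow-zero zero f≡0 = refl
sumBelow-zero (suc c) f≡0 = cong₂ _+_ (f≡0 0) (sumBelow-zero c (f≡0 ∘ suc))

sumBelow-truncate : ∀ {c d} (f : ℕ → ℕ) → c ≤ d → (∀ x → c ≤ x → f x ≡ 0) → sumBelow d f ≡ sumBelow c f
sumBelow-truncate {zero} {d} f _ f≡0 = sumBelow-zero d (λ x → f≡0 x z≤n)
sumBelow-truncate {suc c} {suc d} f (s≤s c≤d) f≡0 =
  cong (f 0 +_) (sumBelow-truncate (f ∘ suc) c≤d (λ x c≤x → f≡0 (suc x) (s≤s c≤x)))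

sumBelow-shift : ∀ r c (f : ℕ → ℕ) → (∀ x → x < r → f x ≡ 0) → sumBelow (r + c) f ≡ sumBelow c (λ y → f (r + y))
sumBelow-shift zero c f _ = refl
sumBelow-shift (suc r) c f f≡0 =
  trans (cong (_+ sumBelow (r + c) (f ∘ suc)) (f≡0 0 (s≤s z≤n)))
        (sumBelow-shift r c (f ∘ suc) (λ x x<r → f≡0 (suc x) (s≤s x<r)))

sumBelow-window : ∀ {r c d} (f : ℕ → ℕ) → r + c ≤ d →
  (∀ x → x < r → f x ≡ 0) → (∀ y → c ≤ y → f (r + y) ≡ 0) → sumBelow d f ≡ sumBelow c (λ y → f (r + y))
sumBelow-window {r} {c} f r+c≤d below above =
  trans (sumBelow-truncate f r+c≤d beyond) (sumBelow-shift r c f below)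
  where
  beyond : ∀ x → r + c ≤ x → f x ≡ 0
  beyond x r+c≤x = begin
    f x             ≡⟨ cong f (m+[n∸m]≡n (m+n≤o⇒m≤o r r+c≤x)) ⟨
    f (r + (x ∸ r)) ≡⟨ above (x ∸ r) (m+n≤o⇒m≤o∸n c (subst (_≤ x) (+-comm r c) r+c≤x)) ⟩
    0               ∎
    where open ≡-Reasoning

count-concatMap : (f : Y → Bool) (g : ℕ → List Y) (h : ℕ → ℕ) (c : ℕ) →
  count f (concatMap g (applyUpTo h c)) ≡ sumBelow c (λ x → count f (g (h x)))
count-concatMap f g h zero = refl
count-concatMap f g h (suc c) =
  trans (count-++ f (g (h 0)) _) (cong (count f (g (h 0)) +_) (count-concatMap f g (h ∘ suc) c))

count-allVecs : ∀ k b (f : Vec ℕ (suc k) → Bool) →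
  count f (allVecs (suc k) b) ≡ sumBelow (suc b) (λ x → count (f ∘ (x ∷_)) (allVecs k b))
count-allVecs k b f =
  trans (count-concatMap f (λ x → map (x ∷_) (allVecs k b)) (λ x → x) (suc b))
        (sumBelow-cong (suc b) (λ x → count-map f (x ∷_) (allVecs k b)))

+-cancel-⇔ : ∀ u {v w} → (u + v ≡ u + w) ⇔ (v ≡ w)
+-cancel-⇔ u = mk⇔ (+-cancelˡ-≡ u _ _) (cong (u +_))

∸-shift-⇔ : ∀ {c m w W} → c ≤ m → (c + w ≡ W + m) ⇔ (w ≡ W + (m ∸ c))
∸-shift-⇔ {c} {m} {w} {W} c≤m = subst (λ z → (c + w ≡ z) ⇔ (w ≡ W + (m ∸ c))) rearrange (+-cancel-⇔ c)
  where
  rearrange : c + (W + (m ∸ c)) ≡ W + m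
  rearrange = trans (x+[y+z]≡y+[x+z] c W (m ∸ c)) (cong (W +_) (m+[n∸m]≡n c≤m))
    where
    open +-*-Solver
    x+[y+z]≡y+[x+z] : ∀ x y z → x + (y + z) ≡ y + (x + z)
    x+[y+z]≡y+[x+z] = solve 3 (λ x y z → x :+ (y :+ z) := y :+ (x :+ z)) refl

*-+-cancel-⇔ : ∀ s r₀ y w W m → (s * (r₀ + y) + w ≡ s * r₀ + W + m) ⇔ (s * y + w ≡ W + m)
*-+-cancel-⇔ s r₀ y w W m =
  subst₂ (λ lhs rhs → (lhs ≡ rhs) ⇔ (s * y + w ≡ W + m)) (sym distrib) (sym (+-assoc (s * r₀) W m)) (+-cancel-⇔ (s * r₀))
  where
  distrib : s * (r₀ + y) + w ≡ s * r₀ + (s * y + w)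
  distrib = trans (cong (_+ w) (*-distribˡ-+ s r₀ y)) (+-assoc (s * r₀) (s * y) w)

overshoot : ∀ {c m w W} → m < c → W ≤ w → c + w ≢ W + m
overshoot {c} {m} {w} {W} m<c W≤w eq = <-irrefl (sym eq) (subst (W + m <_) (+-comm w c) (+-mono-≤-< W≤w m<c))

[m+n]%d≡m%d⇒d∣n : ∀ m n d .{{_ : NonZero d}} → (m + n) % d ≡ m % d → d ∣ n
[m+n]%d≡m%d⇒d∣n m n d eq = ∣m+n∣m⇒∣n (divides ((m + n) / d) quotients) (divides (m / d) refl)
  where
  quotients : (m / d) * d + n ≡ ((m + n) / d) * d
  quotients = +-cancelˡ-≡ (m % d) _ _ (begin
    m % d + ((m / d) * d + n)     ≡⟨ +-assoc (m % d) _ n ⟨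
    m % d + (m / d) * d + n       ≡⟨ cong (_+ n) (m≡m%n+[m/n]*n m d) ⟨
    m + n                         ≡⟨ m≡m%n+[m/n]*n (m + n) d ⟩
    (m + n) % d + ((m + n) / d) * d ≡⟨ cong (_+ ((m + n) / d) * d) eq ⟩
    m % d + ((m + n) / d) * d     ∎)
    where open ≡-Reasoning

_≤ᵛ_ : ∀ {k} → Vec ℕ k → Vec ℕ k → Bool
[] ≤ᵛ [] = true
(r ∷ rs) ≤ᵛ (x ∷ xs) = does (r ≤? x) ∧ (rs ≤ᵛ xs)

weightFrom-mono : ∀ {k} s (r v : Vec ℕ k) → (r ≤ᵛ v) ≡ true → weightFrom s r ≤ weightFrom s v
weightFrom-mono s [] [] _ = z≤n
weightFrom-mono s (r ∷ rs) (x ∷ xs) r∷rs≤x∷xs =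
  +-mono-≤ (*-monoʳ-≤ s (from-does (r ≤? x) (∧-conicalˡ _ _ r∷rs≤x∷xs)))
           (weightFrom-mono (suc s) rs xs (∧-conicalʳ _ _ r∷rs≤x∷xs))

weightFrom-replicate-0 : ∀ k s → weightFrom s (replicate k 0) ≡ 0
weightFrom-replicate-0 zero s = refl
weightFrom-replicate-0 (suc k) s = cong₂ _+_ (*-zeroʳ s) (weightFrom-replicate-0 k (suc s))

replicate-0-≤ᵛ : ∀ {k} (v : Vec ℕ k) → (replicate k 0 ≤ᵛ v) ≡ true
replicate-0-≤ᵛ [] = refl
replicate-0-≤ᵛ (x ∷ v) = replicate-0-≤ᵛ v

multOf-replicate-0 : ∀ k q → multOf (replicate k 0) q ≡ 0
multOf-replicate-0 k zero = refl
multOf-replicate-0 zero (suc q) = refl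
multOf-replicate-0 (suc k) (suc zero) = refl
multOf-replicate-0 (suc k) (suc (suc q)) = multOf-replicate-0 k (suc q)

multOf-out-of-range : ∀ {k} (v : Vec ℕ k) q → k < q → multOf v q ≡ 0
multOf-out-of-range v zero _ = refl
multOf-out-of-range [] (suc q) _ = refl
multOf-out-of-range (x ∷ v) (suc (suc q)) (s≤s k<q) = multOf-out-of-range v (suc q) k<q

addPart : ∀ {k} → ℕ → Vec ℕ k → Vec ℕ k
addPart zero v = v
addPart (suc q) [] = []
addPart (suc zero) (x ∷ v) = suc x ∷ v
addPart (suc (suc q)) (x ∷ v) = x ∷ addPart (suc q) v

addPart-≤ᵛ : ∀ {k} q (r v : Vec ℕ k) → q < k →
  (addPart (suc q) r ≤ᵛ v) ≡ (r ≤ᵛ v) ∧ does (suc (multOf r (suc q)) ≤? multOf v (suc q))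
addPart-≤ᵛ zero (r₀ ∷ r) (x ∷ v) _ = absorb (r₀ ≤? x) (suc r₀ ≤? x) (≤-trans (n≤1+n r₀)) (r ≤ᵛ v)
  where
  absorb : ∀ {P Q : Set} (P? : Dec P) (Q? : Dec Q) → (Q → P) → ∀ b → does Q? ∧ b ≡ (does P? ∧ b) ∧ does Q?
  absorb P? (no _) _ b = sym (∧-zeroʳ _)
  absorb (yes _) (yes _) _ b = sym (∧-identityʳ b)
  absorb (no ¬p) (yes q) Q⇒P b = contradiction (Q⇒P q) ¬p
addPart-≤ᵛ (suc q) (r₀ ∷ r) (x ∷ v) (s≤s q<k) =
  trans (cong (does (r₀ ≤? x) ∧_) (addPart-≤ᵛ q r v q<k)) (sym (∧-assoc (does (r₀ ≤? x)) (r ≤ᵛ v) _))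

multOf-addPart : ∀ {k} q q′ (r : Vec ℕ k) → q ≢ q′ → multOf (addPart q r) q′ ≡ multOf r q′
multOf-addPart zero q′ r _ = refl
multOf-addPart (suc q) q′ [] _ = refl
multOf-addPart (suc q) zero (x ∷ r) _ = refl
multOf-addPart (suc zero) (suc zero) (x ∷ r) q≢q′ = contradiction refl q≢q′
multOf-addPart (suc zero) (suc (suc q′)) (x ∷ r) _ = refl
multOf-addPart (suc (suc q)) (suc zero) (x ∷ r) _ = refl
multOf-addPart (suc (suc q)) (suc (suc q′)) (x ∷ r) q≢q′ = multOf-addPart (suc q) (suc q′) r (q≢q′ ∘ cong suc)

weightFrom-addPart : ∀ {k} s q (r : Vec ℕ k) → q < k → weightFrom s (addPart (suc q) r) ≡ weightFrom s r + (s + q)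
weightFrom-addPart s zero (r₀ ∷ r) _ =
  solve 3 (λ s r₀ W → s :* (con 1 :+ r₀) :+ W := s :* r₀ :+ W :+ (s :+ con 0)) refl s r₀ (weightFrom (suc s) r)
  where open +-*-Solver
weightFrom-addPart s (suc q) (r₀ ∷ r) (s≤s q<k) rewrite weightFrom-addPart (suc s) q r q<k =
  solve 4 (λ s r₀ W q → s :* r₀ :+ (W :+ (con 1 :+ s :+ q)) := s :* r₀ :+ W :+ (s :+ (con 1 :+ q)))
        refl s r₀ (weightFrom (suc s) r) q
  where open +-*-Solver

-- Partitions with parts in a range

-- The number of partitions of m into parts from s, s + 1, …, s + k ∸ 1.
pRange : ℕ → ℕ → ℕ → ℕ
pRange zero s m = ⟦ does (0 ≟ m) ⟧
pRange (suc k) s m = sumBelow (suc m) (λ x → if does (s * x ≤? m) then pRange k (suc s) (m ∸ s * x) else 0)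

module _ {k : ℕ} (s r₀ : ℕ) (r : Vec ℕ k) (m : ℕ) where

  dominatingWithHead : ℕ → Vec ℕ k → Bool
  dominatingWithHead x v = does (weightFrom s (x ∷ v) ≟ weightFrom s (r₀ ∷ r) + m) ∧ ((r₀ ∷ r) ≤ᵛ (x ∷ v))

  count-head-below : ∀ b x → x < r₀ → count (dominatingWithHead x) (allVecs k b) ≡ 0
  count-head-below b x x<r₀ = count-false (λ v →
    trans (cong (λ z → does (weightFrom s (x ∷ v) ≟ weightFrom s (r₀ ∷ r) + m) ∧ (z ∧ (r ≤ᵛ v))) (dec-false (r₀ ≤? x) (<⇒≱ x<r₀)))
          (∧-zeroʳ _)) (allVecs k b)

  count-head-shifted : ∀ b →
    (∀ m′ → m′ ≤ m → count (λ v → does (weightFrom (suc s) v ≟ weightFrom (suc s) r + m′) ∧ (r ≤ᵛ v)) (allVecs k b) ≡ pRange k (suc s) m′) →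
    ∀ y → count (dominatingWithHead (r₀ + y)) (allVecs k b) ≡ (if does (s * y ≤? m) then pRange k (suc s) (m ∸ s * y) else 0)
  count-head-shifted b tail-count y with s * y ≤? m
  ... | yes sy≤m = begin
    count (dominatingWithHead (r₀ + y)) (allVecs k b)
      ≡⟨ count-cong (λ v → cong₂ _∧_ (does-⇔ (∸-shift-⇔ sy≤m ⇔-∘ *-+-cancel-⇔ s r₀ y (W′ v) W m)
                                               (s * (r₀ + y) + W′ v ≟ s * r₀ + W + m) (W′ v ≟ W + (m ∸ s * y)))
                                     (cong (_∧ (r ≤ᵛ v)) (dec-true (r₀ ≤? r₀ + y) (m≤m+n r₀ y)))) (allVecs k b) ⟩
    count (λ v → does (W′ v ≟ W + (m ∸ s * y)) ∧ (r ≤ᵛ v)) (allVecs k b)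
      ≡⟨ tail-count (m ∸ s * y) (m∸n≤m m (s * y)) ⟩
    pRange k (suc s) (m ∸ s * y)
      ≡⟨ if-yes (s * y ≤? m) sy≤m ⟨
    (if does (s * y ≤? m) then pRange k (suc s) (m ∸ s * y) else 0) ∎
    where
    open ≡-Reasoning
    W = weightFrom (suc s) r
    W′ = weightFrom (suc s)
  ... | no sy≰m = trans (count-false overweight (allVecs k b)) (sym (if-no (s * y ≤? m) sy≰m))
    where
    overweight : ∀ v → dominatingWithHead (r₀ + y) v ≡ false
    overweight v with r ≤ᵛ v in r≤v
    ... | false = trans (sym (∧-assoc (does (weightFrom s (r₀ + y ∷ v) ≟ weightFrom s (r₀ ∷ r) + m)) _ false)) (∧-zeroʳ _)
    ... | true = cong (_∧ (does (r₀ ≤? r₀ + y) ∧ true)) (dec-false (_ ≟ _)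
      (overshoot (≰⇒> sy≰m) (weightFrom-mono (suc s) r v r≤v) ∘ Equivalence.to (*-+-cancel-⇔ s r₀ y _ _ m)))

-- v ↦ v − r matches the vectors v ≥ r of weight |r| + m with the vectors of weight m counted by
-- pRange; the bound on b ensures that no such v has an entry beyond b.
count-dominating : ∀ k b s .{{_ : NonZero s}} (r : Vec ℕ k) m → weightFrom s r + m ≤ b →
  count (λ v → does (weightFrom s v ≟ weightFrom s r + m) ∧ (r ≤ᵛ v)) (allVecs k b) ≡ pRange k s m
count-dominating zero b s [] m _ = trans (+-identityʳ _) (cong ⟦_⟧ (∧-identityʳ _))
count-dominating (suc k) b s (r₀ ∷ r) m bound = begin
  count _ (allVecs (suc k) b)
    ≡⟨ count-allVecs k b _ ⟩
  sumBelow (suc b) (λ x → count (dominatingWithHead s r₀ r m x) (allVecs k b))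
    ≡⟨ sumBelow-window _ window (count-head-below s r₀ r m b) above ⟩
  sumBelow (suc m) (λ y → count (dominatingWithHead s r₀ r m (r₀ + y)) (allVecs k b))
    ≡⟨ sumBelow-cong (suc m) (count-head-shifted s r₀ r m b tail-count) ⟩
  pRange (suc k) s m ∎
  where
  open ≡-Reasoning
  W = weightFrom (suc s) r
  W+m≤b : W + m ≤ b
  W+m≤b = ≤-trans (m≤n+m (W + m) (s * r₀)) (≤-trans (≤-reflexive (sym (+-assoc (s * r₀) W m))) bound)
  window : r₀ + suc m ≤ suc b
  window = ≤-trans (≤-reflexive (+-suc r₀ m)) (s≤s (≤-trans (+-monoˡ-≤ m (≤-trans (m≤n*m r₀ s) (m≤m+n (s * r₀) W))) bound))
  tail-count : ∀ m′ → m′ ≤ m → count (λ v → does (weightFrom (suc s) v ≟ W + m′) ∧ (r ≤ᵛ v)) (allVecs k b) ≡ pRange k (suc s) m′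
  tail-count m′ m′≤m = count-dominating k b (suc s) r m′ (≤-trans (+-monoʳ-≤ W m′≤m) W+m≤b)
  above : ∀ y → suc m ≤ y → count (dominatingWithHead s r₀ r m (r₀ + y)) (allVecs k b) ≡ 0
  above y m<y = trans (count-head-shifted s r₀ r m b tail-count y) (if-no (s * y ≤? m) (<⇒≱ (<-≤-trans m<y (m≤n*m y s))))

count-weight : ∀ k b s .{{_ : NonZero s}} m → m ≤ b →
  count (λ v → does (weightFrom s v ≟ m)) (allVecs k b) ≡ pRange k s m
count-weight k b s m m≤b = trans (count-cong with-zero-lower-bound (allVecs k b))
  (count-dominating k b s (replicate k 0) m (subst (_≤ b) (cong (_+ m) (sym (weightFrom-replicate-0 k s))) m≤b))
  where
  with-zero-lower-bound : ∀ v → does (weightFrom s v ≟ m) ≡ does (weightFrom s v ≟ weightFrom s (replicate k 0) + m) ∧ (replicate k 0 ≤ᵛ v)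
  with-zero-lower-bound v rewrite weightFrom-replicate-0 k s | replicate-0-≤ᵛ v = sym (∧-identityʳ _)

pRange-large-parts : ∀ k s m → m < s → pRange k s m ≡ ⟦ does (0 ≟ m) ⟧
pRange-large-parts zero s m _ = refl
pRange-large-parts (suc k) s m m<s = begin
  (if does (s * 0 ≤? m) then pRange k (suc s) (m ∸ s * 0) else 0) + sumBelow m (λ x → summand (suc x))
    ≡⟨ cong₂ _+_ only-zero-copies (sumBelow-zero m λ x → if-no (s * suc x ≤? m) (too-big x)) ⟩
  ⟦ does (0 ≟ m) ⟧ + 0
    ≡⟨ +-identityʳ _ ⟩
  ⟦ does (0 ≟ m) ⟧ ∎
  where
  open ≡-Reasoning
  summand : ℕ → ℕ
  summand x = if does (s * x ≤? m) then pRange k (suc s) (m ∸ s * x) else 0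
  too-big : ∀ x → ¬ s * suc x ≤ m
  too-big x sx≤m = <⇒≱ m<s (≤-trans (m≤m*n s (suc x)) sx≤m)
  only-zero-copies : summand 0 ≡ ⟦ does (0 ≟ m) ⟧
  only-zero-copies rewrite *-zeroʳ s = pRange-large-parts k (suc s) m (m<n⇒m<1+n m<s)

pRange-suc : ∀ k s m → m < s + k → pRange (suc k) s m ≡ pRange k s m
pRange-suc zero s m m<s+0 = pRange-large-parts 1 s m (subst (m <_) (+-identityʳ s) m<s+0)
pRange-suc (suc k) s m m<s+1+k = sumBelow-cong (suc m) λ x →
  cong (λ z → if does (s * x ≤? m) then z else 0) (pRange-suc k (suc s) (m ∸ s * x)
    (≤-<-trans (m∸n≤m m (s * x)) (subst (m <_) (+-suc s k) m<s+1+k)))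

pRange-stable : ∀ j k s m → m < s + k → pRange (j + k) s m ≡ pRange k s m
pRange-stable zero k s m _ = refl
pRange-stable (suc j) k s m m<s+k =
  trans (pRange-suc (j + k) s m (<-≤-trans m<s+k (+-monoʳ-≤ s (m≤n+m k j)))) (pRange-stable j k s m m<s+k)

pRange-1≡p : ∀ {n m} → m ≤ n → pRange n 1 m ≡ p m
pRange-1≡p {n} {m} m≤n = begin
  pRange n 1 m
    ≡⟨ cong (λ k → pRange k 1 m) (m∸n+n≡m m≤n) ⟨
  pRange (n ∸ m + m) 1 m
    ≡⟨ pRange-stable (n ∸ m) m 1 m ≤-refl ⟩
  pRange m 1 m
    ≡⟨ count-weight m m 1 m ≤-refl ⟨
  count (λ v → does (weight v ≟ m)) (allVecs m m)
    ≡⟨ length-filter (λ v → weight v ≟ m) (allVecs m m) ⟨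
  p m ∎
  where open ≡-Reasoning

pℤ-∸ : ∀ {n S} → S ≤ n → pℤ (ℤ.+ n ℤ.- ℤ.+ S) ≡ p (n ∸ S)
pℤ-∸ {n} {S} S≤n rewrite ℤP.m-n≡m⊖n n S | ℤP.⊖-≥ S≤n = refl

pℤ-neg : ∀ {n S} → n < S → pℤ (ℤ.+ n ℤ.- ℤ.+ S) ≡ 0
pℤ-neg {n} {S} n<S rewrite ℤP.m-n≡m⊖n n S | ℤP.⊖-< n<S with S ∸ n | m<n⇒0<n∸m n<S
... | suc _ | _ = refl

count-containing : ∀ n (r : Vec ℕ n) →
  count (λ v → does (weight v ≟ n) ∧ (r ≤ᵛ v)) (allVecs n n) ≡ pℤ (ℤ.+ n ℤ.- ℤ.+ weight r)
count-containing n r with weight r ≤? n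
... | yes r≤n = begin
  count (λ v → does (weight v ≟ n) ∧ (r ≤ᵛ v)) (allVecs n n)
    ≡⟨ count-cong (λ v → cong (λ m → does (weight v ≟ m) ∧ (r ≤ᵛ v)) (m+[n∸m]≡n r≤n)) (allVecs n n) ⟨
  count (λ v → does (weight v ≟ weight r + (n ∸ weight r)) ∧ (r ≤ᵛ v)) (allVecs n n)
    ≡⟨ count-dominating n n 1 r (n ∸ weight r) (≤-reflexive (m+[n∸m]≡n r≤n)) ⟩
  pRange n 1 (n ∸ weight r)
    ≡⟨ pRange-1≡p (m∸n≤m n (weight r)) ⟩
  p (n ∸ weight r)
    ≡⟨ pℤ-∸ r≤n ⟨
  pℤ (ℤ.+ n ℤ.- ℤ.+ weight r) ∎
  where open ≡-Reasoning
... | no r≰n = trans (count-false too-heavy (allVecs n n)) (sym (pℤ-neg (≰⇒> r≰n)))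
  where
  too-heavy : ∀ v → does (weight v ≟ n) ∧ (r ≤ᵛ v) ≡ false
  too-heavy v with r ≤ᵛ v in r≤v
  ... | false = ∧-zeroʳ _
  ... | true = trans (∧-identityʳ _) (dec-false (weight v ≟ n) λ v≡n → r≰n (subst (weight r ≤_) v≡n (weightFrom-mono 1 r v r≤v)))

-- Parity and telescoping

even : ℕ → Bool
even zero = true
even (suc n) = not (even n)

_∈_+2ℕ : ℕ → ℕ → Bool
m ∈ t +2ℕ = does (t ≤? m) ∧ even (m ∸ t)

∈+2ℕ⇒≤ : ∀ {t m} → (m ∈ t +2ℕ) ≡ true → t ≤ m
∈+2ℕ⇒≤ {t} {m} m∈t+2ℕ = from-does (t ≤? m) (∧-conicalˡ _ _ m∈t+2ℕ)

≤-by-parity : ∀ t m → ⟦ does (t ≤? m) ⟧ ≡ ⟦ m ∈ t +2ℕ ⟧ + ⟦ m ∈ suc t +2ℕ ⟧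
≤-by-parity zero zero = refl
≤-by-parity zero (suc m) with even m
... | true = refl
... | false = refl
≤-by-parity (suc t) zero = refl
≤-by-parity (suc zero) (suc m) = ≤-by-parity zero m
≤-by-parity (suc (suc t)) (suc m) = ≤-by-parity (suc t) m

sumFrom1-cong : ∀ N {f g : ℕ → ℤ} → f ≗ g → sumFrom1 N f ≡ sumFrom1 N g
sumFrom1-cong zero f≗g = refl
sumFrom1-cong (suc N) f≗g = cong₂ ℤ._+_ (sumFrom1-cong N f≗g) (f≗g (suc N))

alternating-telescope : (c x : ℕ → ℤ) → (∀ t → x t ≡ c t ℤ.+ c (suc t)) → ∀ N →
  c 0 ≡ x 0 ℤ.+ sumFrom1 N (λ m → x (2 * m) ℤ.- x (2 * m ∸ 1)) ℤ.- c (suc (2 * N))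
alternating-telescope c x x≡c+c zero rewrite x≡c+c 0 =
  solve 2 (λ c₀ c₁ → c₀ := c₀ :+ c₁ :+ con (ℤ.+ 0) :- c₁) refl (c 0) (c 1)
  where open ℤSolver
alternating-telescope c x x≡c+c (suc N) = begin
  c 0
    ≡⟨ alternating-telescope c x x≡c+c N ⟩
  x 0 ℤ.+ Σ ℤ.- c₁
    ≡⟨ regroup (x 0) Σ c₁ c₂ c₃ ⟩
  x 0 ℤ.+ (Σ ℤ.+ ((c₂ ℤ.+ c₃) ℤ.- (c₁ ℤ.+ c₂))) ℤ.- c₃
    ≡⟨ cong₂ (λ u w → x 0 ℤ.+ (Σ ℤ.+ u) ℤ.- w) new-term (cong (c ∘ suc) 2+2N) ⟨
  x 0 ℤ.+ sumFrom1 (suc N) f ℤ.- c (suc (2 * suc N)) ∎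
  where
  open ≡-Reasoning
  f : ℕ → ℤ
  f m = x (2 * m) ℤ.- x (2 * m ∸ 1)
  Σ = sumFrom1 N f
  c₁ = c (1 + 2 * N)
  c₂ = c (2 + 2 * N)
  c₃ = c (3 + 2 * N)
  2+2N : 2 * suc N ≡ 2 + 2 * N
  2+2N = *-suc 2 N
  new-term : f (suc N) ≡ (c₂ ℤ.+ c₃) ℤ.- (c₁ ℤ.+ c₂)
  new-term = cong₂ ℤ._-_ (trans (cong x 2+2N) (x≡c+c _)) (trans (cong (λ t → x (t ∸ 1)) 2+2N) (x≡c+c _))
  regroup : ∀ x₀ Σ c₁ c₂ c₃ → x₀ ℤ.+ Σ ℤ.- c₁ ≡ x₀ ℤ.+ (Σ ℤ.+ ((c₂ ℤ.+ c₃) ℤ.- (c₁ ℤ.+ c₂))) ℤ.- c₃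
  regroup = solve 5 (λ x₀ Σ c₁ c₂ c₃ → x₀ :+ Σ :- c₁ := x₀ :+ (Σ :+ ((c₂ :+ c₃) :- (c₁ :+ c₂))) :- c₃) refl
    where open ℤSolver

-- The mex of a partition

-- A and a are taken as successors so that every part a + jA is of the form suc _, which is how
-- the lemmas on addPart address a part.
module Mex (A′ a′ n : ℕ) where

  A a : ℕ
  A = suc A′
  a = suc a′

  part : ℕ → ℕ
  part j = a + j * A

  partsSum : ℕ → ℕ
  partsSum t = A * (t C 2) + a * t

  partsSum-suc : ∀ t → partsSum (suc t) ≡ partsSum t + part t
  partsSum-suc t rewrite sym (nCk+nC[k+1]≡[n+1]C[k+1] t 1) | nC1≡n t =
    solve 4 (λ A a t c → A :* (t :+ c) :+ a :* (con 1 :+ t) := A :* c :+ a :* t :+ (a :+ t :* A)) refl A a t (t C 2)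
    where open +-*-Solver

  part-< : ∀ t → part t < part (suc t)
  part-< t = +-monoʳ-< a (m<n+m (t * A) (s≤s z≤n))

  part-mono : ∀ {i j} → i ≤ j → part i ≤ part j
  part-mono i≤j = +-monoʳ-≤ a (*-monoˡ-≤ A i≤j)

  n<part-n : n < part n
  n<part-n = s≤s (≤-trans (m≤m*n n A) (m≤n+m (n * A) a′))

  absent : ℕ → Vec ℕ n → Bool
  absent j v = multOf v (part j) ≡ᵇ 0

  allPresent : ℕ → Vec ℕ n → Bool
  allPresent zero v = true
  allPresent (suc t) v = allPresent t v ∧ not (absent t v)

  required : ℕ → Vec ℕ n
  required zero = replicate n 0
  required (suc t) = addPart (part t) (required t)

  multOf-required : ∀ t x → part t ≤ x → multOf (required t) x ≡ 0
  multOf-required zero x _ = multOf-replicate-0 n x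
  multOf-required (suc t) x part≤x =
    trans (multOf-addPart (part t) x (required t) (λ t≡x → <⇒≱ (part-< t) (subst (part (suc t) ≤_) (sym t≡x) part≤x)))
          (multOf-required t x (≤-trans (<⇒≤ (part-< t)) part≤x))

  PartsFit : ℕ → Set
  PartsFit t = ∀ j → j < t → part j ≤ n

  allPresent≡required-≤ᵛ : ∀ t → PartsFit t → ∀ v → allPresent t v ≡ (required t ≤ᵛ v)
  allPresent≡required-≤ᵛ zero _ v = sym (replicate-0-≤ᵛ v)
  allPresent≡required-≤ᵛ (suc t) fit v = begin
    allPresent t v ∧ not (absent t v)
      ≡⟨ cong₂ _∧_ (allPresent≡required-≤ᵛ t (λ j j<t → fit j (m<n⇒m<1+n j<t)) v) (sym (1≤?-≡ (multOf v (part t)))) ⟩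
    (required t ≤ᵛ v) ∧ does (1 ≤? multOf v (part t))
      ≡⟨ cong (λ z → (required t ≤ᵛ v) ∧ does (suc z ≤? multOf v (part t))) (multOf-required t (part t) ≤-refl) ⟨
    (required t ≤ᵛ v) ∧ does (suc (multOf (required t) (part t)) ≤? multOf v (part t))
      ≡⟨ addPart-≤ᵛ (a′ + t * A) (required t) v (fit t ≤-refl) ⟨
    required (suc t) ≤ᵛ v ∎
    where
    open ≡-Reasoning
    1≤?-≡ : ∀ x → does (1 ≤? x) ≡ not (x ≡ᵇ 0)
    1≤?-≡ zero = refl
    1≤?-≡ (suc x) = refl

  weight-required : ∀ t → PartsFit t → weight (required t) ≡ partsSum t
  weight-required zero _ = trans (weightFrom-replicate-0 n 1) (sym (cong₂ _+_ (*-zeroʳ A) (*-zeroʳ a)))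
  weight-required (suc t) fit = begin
    weight (addPart (part t) (required t))  ≡⟨ weightFrom-addPart 1 (a′ + t * A) (required t) (fit t ≤-refl) ⟩
    weight (required t) + part t             ≡⟨ cong (_+ part t) (weight-required t (λ j j<t → fit j (m<n⇒m<1+n j<t))) ⟩
    partsSum t + part t                      ≡⟨ partsSum-suc t ⟨
    partsSum (suc t)                         ∎
    where open ≡-Reasoning

  count-allPresent-fitting : ∀ t → PartsFit t → count (allPresent t) (partitions n) ≡ pℤ (ℤ.+ n ℤ.- ℤ.+ partsSum t)
  count-allPresent-fitting t fit = begin
    count (allPresent t) (partitions n)
      ≡⟨ count-filter (λ v → weight v ≟ n) (allPresent t) (allVecs n n) ⟩
    count (λ v → does (weight v ≟ n) ∧ allPresent t v) (allVecs n n)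
      ≡⟨ count-cong (λ v → cong (does (weight v ≟ n) ∧_) (allPresent≡required-≤ᵛ t fit v)) (allVecs n n) ⟩
    count (λ v → does (weight v ≟ n) ∧ (required t ≤ᵛ v)) (allVecs n n)
      ≡⟨ count-containing n (required t) ⟩
    pℤ (ℤ.+ n ℤ.- ℤ.+ weight (required t))
      ≡⟨ cong (λ S → pℤ (ℤ.+ n ℤ.- ℤ.+ S)) (weight-required t fit) ⟩
    pℤ (ℤ.+ n ℤ.- ℤ.+ partsSum t) ∎
    where open ≡-Reasoning

  count-allPresent : ∀ t → count (allPresent t) (partitions n) ≡ pℤ (ℤ.+ n ℤ.- ℤ.+ partsSum t)
  count-allPresent zero = count-allPresent-fitting zero (λ _ ())
  count-allPresent (suc t) with part t ≤? n
  ... | yes part≤n = count-allPresent-fitting (suc t) (λ j j<1+t → ≤-trans (part-mono (≤-pred j<1+t)) part≤n)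
  ... | no part≰n = trans (count-false (λ v → trans (cong (λ b → allPresent t v ∧ not b) (absent-too-big v)) (∧-zeroʳ _))
                                       (partitions n))
                          (sym (pℤ-neg (<-≤-trans (≰⇒> part≰n) (subst (part t ≤_) (sym (partsSum-suc t)) (m≤n+m (part t) (partsSum t))))))
    where
    absent-too-big : ∀ v → absent t v ≡ true
    absent-too-big v rewrite multOf-out-of-range v (part t) (≰⇒> part≰n) = refl

  FirstAbsent : Vec ℕ n → ℕ → Set
  FirstAbsent v μ = (∀ i → i < μ → absent i v ≡ false) × absent μ v ≡ true

  absent-n : ∀ v → absent n v ≡ true
  absent-n v rewrite multOf-out-of-range v (part n) n<part-n = refl

  mexIdxFrom-first-absent : ∀ v fuel j → (∀ i → i < j → absent i v ≡ false) → n < j + fuel →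
    FirstAbsent v (mexIdxFrom A a v fuel j)
  mexIdxFrom-first-absent v zero j present n<j+0 =
    contradiction (trans (sym (absent-n v)) (present n (subst (n <_) (+-identityʳ j) n<j+0))) λ ()
  mexIdxFrom-first-absent v (suc fuel) j present n<j+1+f with absent j v in absent-j
  ... | true = present , absent-j
  ... | false = mexIdxFrom-first-absent v fuel (suc j) present′ (subst (n <_) (+-suc j fuel) n<j+1+f)
    where
    present′ : ∀ i → i < suc j → absent i v ≡ false
    present′ i i<1+j with m≤n⇒m<n∨m≡n (≤-pred i<1+j)
    ... | inj₁ i<j = present i i<j
    ... | inj₂ refl = absent-j

  mexIdx-first-absent : ∀ v → FirstAbsent v (mexIdx A a v)
  mexIdx-first-absent v = mexIdxFrom-first-absent v (suc n) 0 (λ _ ()) ≤-refl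

  first-absent-≤ : ∀ {v μ} → FirstAbsent v μ → μ ≤ n
  first-absent-≤ {v} (present , _) = ≮⇒≥ λ n<μ → contradiction (trans (sym (absent-n v)) (present n n<μ)) λ ()

  allPresent-first-absent : ∀ {v μ} → FirstAbsent v μ → ∀ t → allPresent t v ≡ does (t ≤? μ)
  allPresent-first-absent _ zero = refl
  allPresent-first-absent {v} {μ} (present , absent-μ) (suc t) with <-cmp t μ
  ... | tri< t<μ _ _ = begin
    allPresent t v ∧ not (absent t v) ≡⟨ cong₂ (λ b c → b ∧ not c) (trans IH (dec-true (t ≤? μ) (<⇒≤ t<μ))) (present t t<μ) ⟩
    true                              ≡⟨ dec-true (suc t ≤? μ) t<μ ⟨
    does (suc t ≤? μ)                 ∎
    where open ≡-Reasoning
          IH = allPresent-first-absent (present , absent-μ) t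
  ... | tri≈ _ refl _ = begin
    allPresent t v ∧ not (absent t v) ≡⟨ cong (λ b → allPresent t v ∧ not b) absent-μ ⟩
    allPresent t v ∧ false            ≡⟨ ∧-zeroʳ _ ⟩
    false                             ≡⟨ dec-false (suc t ≤? t) (<-irrefl refl) ⟨
    does (suc t ≤? t)                 ∎
    where open ≡-Reasoning
  ... | tri> _ _ μ<t = begin
    allPresent t v ∧ not (absent t v) ≡⟨ cong (_∧ not (absent t v)) (trans IH (dec-false (t ≤? μ) (<⇒≱ μ<t))) ⟩
    false                             ≡⟨ dec-false (suc t ≤? μ) (<⇒≱ (m<n⇒m<1+n μ<t)) ⟨
    does (suc t ≤? μ)                 ∎
    where open ≡-Reasoning
          IH = allPresent-first-absent (present , absent-μ) t

  mex-parity : ∀ j → does ((a + j * A) % (2 * A) ≟ a % (2 * A)) ≡ even j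
  mex-parity zero = dec-true ((a + 0) % (2 * A) ≟ a % (2 * A)) (cong (_% (2 * A)) (+-identityʳ a))
  mex-parity (suc zero) = dec-false ((a + 1 * A) % (2 * A) ≟ a % (2 * A))
    (>⇒∤ (*-monoˡ-< A {1} {2} (s≤s (s≤s z≤n))) ∘ [m+n]%d≡m%d⇒d∣n a (1 * A) (2 * A))
  mex-parity (suc (suc j)) = begin
    does ((a + (2 + j) * A) % (2 * A) ≟ a % (2 * A)) ≡⟨ cong (λ x → does (x ≟ a % (2 * A))) two-more-steps ⟩
    does ((a + j * A) % (2 * A) ≟ a % (2 * A))       ≡⟨ mex-parity j ⟩
    even j                                          ≡⟨ not-involutive (even j) ⟨
    even (2 + j)                                    ∎
    where
    open ≡-Reasoning
    two-more-steps : (a + (2 + j) * A) % (2 * A) ≡ (a + j * A) % (2 * A)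
    two-more-steps = trans (cong (_% (2 * A)) (solve 3 (λ a j A → a :+ (con 2 :+ j) :* A := a :+ j :* A :+ con 1 :* (con 2 :* A)) refl a j A))
                           ([m+kn]%n≡m%n (a + j * A) 1 (2 * A))
      where open +-*-Solver

  mexParityFrom : ℕ → ℕ
  mexParityFrom t = count (λ v → mexIdx A a v ∈ t +2ℕ) (partitions n)

  pAa≡mexParityFrom-0 : pAa A a n ≡ mexParityFrom 0
  pAa≡mexParityFrom-0 = trans (length-filter _ (partitions n)) (count-cong (mex-parity ∘ mexIdx A a) (partitions n))

  count-allPresent-by-parity : ∀ t → count (allPresent t) (partitions n) ≡ mexParityFrom t + mexParityFrom (suc t)
  count-allPresent-by-parity t = count-+ (λ v →
    trans (cong ⟦_⟧ (allPresent-first-absent (mexIdx-first-absent v) t)) (≤-by-parity t (mexIdx A a v))) (partitions n)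

  mexParityFrom-vanishes : ∀ t → n < t → mexParityFrom t ≡ 0
  mexParityFrom-vanishes t n<t = count-false beyond-n (partitions n)
    where
    beyond-n : ∀ v → (mexIdx A a v ∈ t +2ℕ) ≡ false
    beyond-n v with mexIdx A a v ∈ t +2ℕ in μ∈t+2ℕ
    ... | false = refl
    ... | true = contradiction (≤-trans (∈+2ℕ⇒≤ μ∈t+2ℕ) (first-absent-≤ {v} (mexIdx-first-absent v))) (<⇒≱ n<t)

  term≡allPresent-difference : ∀ m →
    term A a n m ≡ ℤ.+ count (allPresent (2 * m)) (partitions n) ℤ.- ℤ.+ count (allPresent (2 * m ∸ 1)) (partitions n)
  term≡allPresent-difference m = cong₂ (λ u w → ℤ.+ u ℤ.- ℤ.+ w)
    (trans (cong (λ z → pℤ (ℤ.+ n ℤ.- ℤ.+ (A * ((2 * m) C 2) + z))) 2am≡a2m) (sym (count-allPresent (2 * m))))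
    (sym (count-allPresent (2 * m ∸ 1)))
    where
    2am≡a2m : 2 * a * m ≡ a * (2 * m)
    2am≡a2m = trans (cong (_* m) (*-comm 2 a)) (*-assoc a 2 m)

theorem3p2 : (A a : ℕ) → .{{_ : NonZero A}} → .{{_ : NonZero a}} → (n N : ℕ) → n ≤ N →
    ℤ.+ pAa A a n ≡ ℤ.+ p n ℤ.+ sumFrom1 N (term A a n)
theorem3p2 zero _ {{A≢0}} _ _ _ = contradiction refl (≢-nonZero⁻¹ zero {{A≢0}})
theorem3p2 (suc _) zero {{_}} {{a≢0}} _ _ _ = contradiction refl (≢-nonZero⁻¹ zero {{a≢0}})
theorem3p2 (suc A′) (suc a′) n N n≤N = begin
  ℤ.+ pAa A a n
    ≡⟨ cong ℤ.+_ pAa≡mexParityFrom-0 ⟩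
  c 0
    ≡⟨ alternating-telescope c x (cong ℤ.+_ ∘ count-allPresent-by-parity) N ⟩
  x 0 ℤ.+ sumFrom1 N (λ m → x (2 * m) ℤ.- x (2 * m ∸ 1)) ℤ.- c (suc (2 * N))
    ≡⟨ cong₂ (λ s z → x 0 ℤ.+ s ℤ.- ℤ.+ z) (sumFrom1-cong N (sym ∘ term≡allPresent-difference))
             (mexParityFrom-vanishes (suc (2 * N)) (s≤s (≤-trans n≤N (m≤m+n N (N + 0))))) ⟩
  x 0 ℤ.+ sumFrom1 N (term A a n) ℤ.+ ℤ.+ 0
    ≡⟨ ℤP.+-identityʳ _ ⟩
  x 0 ℤ.+ sumFrom1 N (term A a n)
    ≡⟨ cong (λ z → ℤ.+ z ℤ.+ sumFrom1 N (term A a n)) (length≡count-true (partitions n)) ⟨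
  ℤ.+ p n ℤ.+ sumFrom1 N (term A a n) ∎
  where
  open ≡-Reasoning
  open Mex A′ a′ n
  c x : ℕ → ℤ
  c t = ℤ.+ mexParityFrom t
  x t = ℤ.+ count (allPresent t) (partitions n)
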